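{- Let $q$ be a prime power and $m\ge2,\ell\ge1$ integers with $\ell\mid m$, $\ell<m$ and $m/\ell$ even. If the complement $\bar\Gamma_{q,m}(\ell)$ is arc-transitive, then $\Gamma_{q,m}(\ell)$ is a rank-3 graph.
   Context: $S_{q,m}(\ell)=\{x^{q^\ell+1}:x\in\mathbb F_{q^m}^*\}$ and $\Gamma_{q,m}(\ell)$ is the Cayley graph on $\mathbb F_{q^m}$ with $x\sim y$ iff $y-x\in S_{q,m}(\ell)$ (simple under these hypotheses); $\bar\Gamma_{q,m}(\ell)$ is its complement. A graph is arc-transitive if its automorphism group acts transitively on ordered pairs of adjacent vertices. A graph is rank-3 if its automorphism group acts transitively on vertices, on ordered pairs of adjacent vertices, and on ordered pairs of distinct non-adjacent vertices. -}

module Defs where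

open import Level using (0ℓ)
open import Data.Nat using (ℕ; zero; suc; _≥_) renaming (_+_ to _+ℕ_; _^_ to _^ℕ_)
open import Data.Nat.Primality using (Prime)
open import Data.Fin using (Fin)
open import Data.Product using (Σ; ∃; _×_; _,_; proj₁)
open import Relation.Nullary using (¬_)
open import Relation.Binary.PropositionalEquality using (_≡_; _≢_)
open import Algebra.Structures using (IsCommutativeRing)
open import Function.Bundles using (_↔_; Inverse)

IsPrimePower : ℕ → Set
IsPrimePower q = Σ ℕ λ p → Σ ℕ λ k → Prime p × k ≥ 1 × q ≡ p ^ℕ k

record Field : Set₁ where
  infixl 7 _*_
  infixl 6 _+_ _-_
  field
    Carrier : Set
    _+_ _*_ : Carrier → Carrier → Carrier
    -_      : Carrier → Carrier
    0# 1#   : Carrier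
    isCommutativeRing : IsCommutativeRing _≡_ _+_ _*_ -_ 0# 1#
    0≢1     : 0# ≢ 1#
    inverse : ∀ x → x ≢ 0# → Σ Carrier λ y → x * y ≡ 1#

  _-_ : Carrier → Carrier → Carrier
  x - y = x + (- y)

  _^_ : Carrier → ℕ → Carrier
  x ^ zero  = 1#
  x ^ suc n = x * (x ^ n)

record FiniteFieldOfOrder (n : ℕ) : Set₁ where
  field
    field′ : Field
  open Field field′ public
  field
    card : Carrier ↔ Fin n

Graph : Set → Set₁
Graph V = V → V → Set

record Automorphism {V : Set} (G : Graph V) : Set where
  field
    perm : V ↔ V
  σ : V → V
  σ = Inverse.to perm
  field
    preserves : ∀ x y → (G x y → G (σ x) (σ y)) × (G (σ x) (σ y) → G x y)

open Automorphism public

VertexTransitive : {V : Set} → Graph V → Set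
VertexTransitive {V} G = ∀ (x u : V) → Σ (Automorphism G) λ φ → σ φ x ≡ u

ArcTransitive : {V : Set} → Graph V → Set
ArcTransitive {V} G = ∀ (x y u v : V) → G x y → G u v →
  Σ (Automorphism G) λ φ → σ φ x ≡ u × σ φ y ≡ v

NonArcTransitive : {V : Set} → Graph V → Set
NonArcTransitive {V} G = ∀ (x y u v : V) → x ≢ y → ¬ G x y → u ≢ v → ¬ G u v →
  Σ (Automorphism G) λ φ → σ φ x ≡ u × σ φ y ≡ v

Rank3 : {V : Set} → Graph V → Set
Rank3 G = VertexTransitive G × ArcTransitive G × NonArcTransitive G

Complement : {V : Set} → Graph V → Graph V
Complement G x y = x ≢ y × ¬ G x y

module _ {n : ℕ} (F : FiniteFieldOfOrder n) where
  open FiniteFieldOfOrder F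

  S : ℕ → Carrier → Set
  S e z = Σ Carrier λ x → x ≢ 0# × z ≡ x ^ e

  Γ : (q ℓ : ℕ) → Graph Carrier
  Γ q ℓ x y = S ((q ^ℕ ℓ) +ℕ 1) (y - x)

  Γbar : (q ℓ : ℕ) → Graph Carrier
  Γbar q ℓ = Complement (Γ q ℓ)

module Submission where

open import Defs
open import Data.Nat using (ℕ; _≥_; _<_; _^_)
open import Data.Nat.Divisibility using (_∣_; quotient)

open import Level using (0ℓ)
open import Data.Nat as ℕ using (zero; suc)
open import Data.Fin using (Fin)
import Data.Fin.Properties as Fin
open import Data.Product using (Σ; ∃; _×_; _,_; proj₁; proj₂)
open import Function using (_∘_)
open import Function.Bundles using (_↔_; Inverse; mk↔ₛ′)
open import Function.Construct.Composition using (_↔-∘_)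
open import Function.Properties.Inverse using (↔⇒↣)
open import Relation.Nullary using (¬_; Dec)
open import Relation.Nullary.Decidable using (map′; via-injection; decidable-stable; ¬?; _×-dec_)
open import Relation.Binary.Definitions using (Decidable; DecidableEquality; Irreflexive)
open import Relation.Binary.PropositionalEquality
open import Algebra.Bundles using (CommutativeRing)
import Algebra.Properties.Ring as RingProperties
import Algebra.Properties.CommutativeSemigroup as CommutativeSemigroupProperties

-- The Cayley graph of a subgroup D of the units of a field is arc-transitive:
-- the maps z ↦ a z + c with a ∈ D are automorphisms, and D acts regularly on
-- itself.  Over a finite field adjacency is decidable, and then every automorphism
-- of the complement is an automorphism of the graph, so arc-transitivity of the
-- complement is exactly transitivity on non-arcs.

module _ {V : Set} {G : Graph V} where

  _∘-aut_ : Automorphism G → Automorphism G → Automorphism G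
  φ ∘-aut ψ = record
    { perm      = perm φ ↔-∘ perm ψ
    ; preserves = λ x y →
        (proj₁ (preserves φ _ _) ∘ proj₁ (preserves ψ x y))
      , (proj₂ (preserves ψ x y) ∘ proj₂ (preserves φ _ _))
    }

  σ-injective : (φ : Automorphism G) → ∀ {x y} → σ φ x ≡ σ φ y → x ≡ y
  σ-injective φ {x} {y} eq = begin
    x                ≡⟨ sym (strictlyInverseʳ x) ⟩
    from (σ φ x)     ≡⟨ cong from eq ⟩
    from (σ φ y)     ≡⟨ strictlyInverseʳ y ⟩
    y                ∎
    where open Inverse (perm φ); open ≡-Reasoning

module _ {V : Set} {G : Graph V} (irreflexive : Irreflexive _≡_ G) (G? : Decidable G) where

  complement-automorphism : Automorphism (Complement G) → Automorphism G
  complement-automorphism φ = record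
    { perm      = perm φ
    ; preserves = λ x y → preserves-arcs x y , reflects-arcs x y
    }
    where
    preserves-arcs : ∀ x y → G x y → G (σ φ x) (σ φ y)
    preserves-arcs x y Gxy = decidable-stable (G? _ _) λ ¬Gσ →
      proj₂ (proj₂ (preserves φ x y) (σx≢σy , ¬Gσ)) Gxy
      where
      σx≢σy : σ φ x ≢ σ φ y
      σx≢σy eq = irreflexive (σ-injective φ eq) Gxy

    reflects-arcs : ∀ x y → G (σ φ x) (σ φ y) → G x y
    reflects-arcs x y Gσ = decidable-stable (G? _ _) λ ¬Gxy →
      proj₂ (proj₁ (preserves φ x y) (x≢y , ¬Gxy)) Gσ
      where
      x≢y : x ≢ y
      x≢y eq = irreflexive (cong (σ φ) eq) Gσ

  arcTransitive-complement⇒nonArcTransitive :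
    ArcTransitive (Complement G) → NonArcTransitive G
  arcTransitive-complement⇒nonArcTransitive H x y u v x≢y ¬Gxy u≢v ¬Guv
    with φ , φx≡u , φy≡v ← H x y u v (x≢y , ¬Gxy) (u≢v , ¬Guv)
    = complement-automorphism φ , φx≡u , φy≡v

module _ {A : Set} {n : ℕ} (A↔Fin : A ↔ Fin n) where
  open Inverse A↔Fin

  ↔Fin⇒≟ : DecidableEquality A
  ↔Fin⇒≟ = via-injection (↔⇒↣ A↔Fin) Fin._≟_

  ↔Fin⇒any? : {P : A → Set} → (∀ x → Dec (P x)) → Dec (∃ P)
  ↔Fin⇒any? {P} P? = map′
    (λ (i , p) → from i , p)
    (λ (x , p) → to x , subst P (sym (strictlyInverseʳ x)) p)
    (Fin.any? (P? ∘ from))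

module _ (K : Field) where
  open Field K renaming (_^_ to _^ᴷ_)
  private
    commutativeRing : CommutativeRing 0ℓ 0ℓ
    commutativeRing = record { isCommutativeRing = isCommutativeRing }
  open CommutativeRing commutativeRing
    using (ring; +-commutativeSemigroup; *-commutativeSemigroup;
           +-comm; +-identityˡ; +-identityʳ; -‿inverseʳ;
           *-assoc; *-comm; *-identityˡ; *-identityʳ; zeroˡ; zeroʳ)
  open RingProperties ring using (//-rightDividesˡ; //-rightDividesʳ; -‿+-comm; x[y-z]≈xy-xz)
  open CommutativeSemigroupProperties +-commutativeSemigroup using () renaming (interchange to +-interchange)
  open CommutativeSemigroupProperties *-commutativeSemigroup using () renaming (interchange to *-interchange)
  open ≡-Reasoning

  Cayley : (Carrier → Set) → Graph Carrier
  Cayley D x y = D (y - x)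

  record IsUnitSubgroup (D : Carrier → Set) : Set where
    field
      *-closed       : ∀ {a b} → D a → D b → D (a * b)
      inverse-closed : ∀ {a} → D a → Σ Carrier λ b → D b × a * b ≡ 1#

  translation-difference : ∀ c x y → (y + c) - (x + c) ≡ y - x
  translation-difference c x y = begin
    (y + c) + - (x + c)     ≡⟨ cong ((y + c) +_) (sym (-‿+-comm x c)) ⟩
    (y + c) + (- x + - c)   ≡⟨ +-interchange y c (- x) (- c) ⟩
    (y - x) + (c - c)       ≡⟨ cong ((y - x) +_) (-‿inverseʳ c) ⟩
    (y - x) + 0#            ≡⟨ +-identityʳ (y - x) ⟩
    y - x                   ∎

  module _ {D : Carrier → Set} where

    translation : Carrier → Automorphism (Cayley D)
    translation c = record
      { perm      = mk↔ₛ′ (_+ c) (_- c) (//-rightDividesˡ c) (//-rightDividesʳ c)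
      ; preserves = λ x y →
          subst D (sym (translation-difference c x y))
        , subst D (translation-difference c x y)
      }

    cayley-vertexTransitive : VertexTransitive (Cayley D)
    cayley-vertexTransitive x u = translation (u - x) , (begin
      x + (u - x)   ≡⟨ +-comm x (u - x) ⟩
      (u - x) + x   ≡⟨ //-rightDividesˡ x u ⟩
      u             ∎)

  inverse-cancel : ∀ {a b} → a * b ≡ 1# → ∀ z → a * (b * z) ≡ z
  inverse-cancel {a} {b} ab≡1 z = begin
    a * (b * z)   ≡⟨ sym (*-assoc a b z) ⟩
    (a * b) * z   ≡⟨ cong (_* z) ab≡1 ⟩
    1# * z        ≡⟨ *-identityˡ z ⟩
    z             ∎

  module _ {D : Carrier → Set} (D-subgroup : IsUnitSubgroup D) where
    open IsUnitSubgroup D-subgroup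

    0∉ : ¬ D 0#
    0∉ D0 with _ , _ , 0b≡1 ← inverse-closed D0 = 0≢1 (trans (sym (zeroˡ _)) 0b≡1)

    division-closed : ∀ {s t} → D s → D t → Σ Carrier λ a → D a × a * s ≡ t
    division-closed {s} {t} Ds Dt with s⁻¹ , Ds⁻¹ , ss⁻¹≡1 ← inverse-closed Ds =
      t * s⁻¹ , *-closed Dt Ds⁻¹ , (begin
        (t * s⁻¹) * s   ≡⟨ *-assoc t s⁻¹ s ⟩
        t * (s⁻¹ * s)   ≡⟨ cong (t *_) (trans (*-comm s⁻¹ s) ss⁻¹≡1) ⟩
        t * 1#          ≡⟨ *-identityʳ t ⟩
        t               ∎)

    scaling : ∀ {a} → D a → Automorphism (Cayley D)
    scaling {a} Da with b , Db , ab≡1 ← inverse-closed Da = record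
      { perm      = mk↔ₛ′ (a *_) (b *_) (inverse-cancel ab≡1) (inverse-cancel ba≡1)
      ; preserves = λ x y →
          (λ Dy-x → subst D (x[y-z]≈xy-xz a y x) (*-closed Da Dy-x))
        , (λ Day-ax → subst D (inverse-cancel ba≡1 (y - x))
                        (*-closed Db (subst D (sym (x[y-z]≈xy-xz a y x)) Day-ax)))
      }
      where
      ba≡1 : b * a ≡ 1#
      ba≡1 = trans (*-comm b a) ab≡1

    cayley-irreflexive : Irreflexive _≡_ (Cayley D)
    cayley-irreflexive {x} refl Dx-x = 0∉ (subst D (-‿inverseʳ x) Dx-x)

    -- z ↦ a (z - x) + u, where a (y - x) = v - u
    cayley-arcTransitive : ArcTransitive (Cayley D)
    cayley-arcTransitive x y u v Dy-x Dv-u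
      with a , Da , a[y-x]≡v-u ← division-closed Dy-x Dv-u =
      translation {D} u ∘-aut (scaling Da ∘-aut translation {D} (- x)) ,
      (begin
        a * (x - x) + u   ≡⟨ cong (λ z → a * z + u) (-‿inverseʳ x) ⟩
        a * 0# + u        ≡⟨ cong (_+ u) (zeroʳ a) ⟩
        0# + u            ≡⟨ +-identityˡ u ⟩
        u                 ∎) ,
      (begin
        a * (y - x) + u   ≡⟨ cong (_+ u) a[y-x]≡v-u ⟩
        (v - u) + u       ≡⟨ //-rightDividesˡ u v ⟩
        v                 ∎)

  *-nonZero : ∀ {x y} → x ≢ 0# → y ≢ 0# → x * y ≢ 0#
  *-nonZero {x} {y} x≢0 y≢0 xy≡0 with x⁻¹ , xx⁻¹≡1 ← inverse x x≢0 = y≢0 (begin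
    y                ≡⟨ sym (inverse-cancel (trans (*-comm x⁻¹ x) xx⁻¹≡1) y) ⟩
    x⁻¹ * (x * y)    ≡⟨ cong (x⁻¹ *_) xy≡0 ⟩
    x⁻¹ * 0#         ≡⟨ zeroʳ x⁻¹ ⟩
    0#               ∎)

  inverse-nonZero : ∀ {x y} → x * y ≡ 1# → y ≢ 0#
  inverse-nonZero {x} xy≡1 refl = 0≢1 (trans (sym (zeroʳ x)) xy≡1)

  ^-distribʳ-* : ∀ x y k → (x * y) ^ᴷ k ≡ (x ^ᴷ k) * (y ^ᴷ k)
  ^-distribʳ-* x y zero    = sym (*-identityʳ 1#)
  ^-distribʳ-* x y (suc k) = begin
    (x * y) * (x * y) ^ᴷ k           ≡⟨ cong ((x * y) *_) (^-distribʳ-* x y k) ⟩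
    (x * y) * (x ^ᴷ k * y ^ᴷ k)      ≡⟨ *-interchange x y (x ^ᴷ k) (y ^ᴷ k) ⟩
    (x * x ^ᴷ k) * (y * y ^ᴷ k)      ∎

  1^k≡1 : ∀ k → 1# ^ᴷ k ≡ 1#
  1^k≡1 zero    = refl
  1^k≡1 (suc k) = trans (*-identityˡ _) (1^k≡1 k)

  Powers : ℕ → Carrier → Set
  Powers e z = Σ Carrier λ x → x ≢ 0# × z ≡ x ^ᴷ e

  powers-isUnitSubgroup : ∀ e → IsUnitSubgroup (Powers e)
  powers-isUnitSubgroup e = record { *-closed = *-closed ; inverse-closed = inverse-closed }
    where
    *-closed : ∀ {a b} → Powers e a → Powers e b → Powers e (a * b)
    *-closed (x , x≢0 , a≡xᵉ) (y , y≢0 , b≡yᵉ) =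
      x * y , *-nonZero x≢0 y≢0 , trans (cong₂ _*_ a≡xᵉ b≡yᵉ) (sym (^-distribʳ-* x y e))

    inverse-closed : ∀ {a} → Powers e a → Σ Carrier λ b → Powers e b × a * b ≡ 1#
    inverse-closed {a} (x , x≢0 , a≡xᵉ) with x⁻¹ , xx⁻¹≡1 ← inverse x x≢0 =
      x⁻¹ ^ᴷ e , (x⁻¹ , inverse-nonZero xx⁻¹≡1 , refl) , (begin
        a * x⁻¹ ^ᴷ e          ≡⟨ cong (_* x⁻¹ ^ᴷ e) a≡xᵉ ⟩
        x ^ᴷ e * x⁻¹ ^ᴷ e     ≡⟨ sym (^-distribʳ-* x x⁻¹ e) ⟩
        (x * x⁻¹) ^ᴷ e        ≡⟨ cong (_^ᴷ e) xx⁻¹≡1 ⟩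
        1# ^ᴷ e               ≡⟨ 1^k≡1 e ⟩
        1#                    ∎)

module _ {n : ℕ} (F : FiniteFieldOfOrder n) where
  open FiniteFieldOfOrder F renaming (_^_ to _^ᴷ_)

  powers? : ∀ e z → Dec (Powers field′ e z)
  powers? e z = ↔Fin⇒any? card λ x → ¬? (x ≟ 0#) ×-dec (z ≟ (x ^ᴷ e))
    where
    _≟_ : DecidableEquality Carrier
    _≟_ = ↔Fin⇒≟ card

-- Only the connection set being a group of units matters.
proposition6p5 : (q m ℓ : ℕ) → IsPrimePower q → m ≥ 2 → ℓ ≥ 1 →
    (ℓ∣m : ℓ ∣ m) → ℓ < m → 2 ∣ quotient ℓ∣m →
    (F : FiniteFieldOfOrder (q ^ m)) →
    ArcTransitive (Γbar F q ℓ) → Rank3 (Γ F q ℓ)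
proposition6p5 q m ℓ _ _ _ _ _ _ F Γbar-arcTransitive =
    cayley-vertexTransitive K {Powers K e}
  , cayley-arcTransitive K powers-subgroup
  , arcTransitive-complement⇒nonArcTransitive
      (cayley-irreflexive K powers-subgroup)
      (λ x y → powers? F e (y - x))
      Γbar-arcTransitive
  where
  open FiniteFieldOfOrder F using (_-_) renaming (field′ to K)
  e : ℕ
  e = q ^ ℓ ℕ.+ 1
  powers-subgroup : IsUnitSubgroup K (Powers K e)
  powers-subgroup = powers-isUnitSubgroup K e
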